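{- Let $w\in S_n$, let $v=w_0(J(w))$, and let $1\le a<b\le n$. Then $v^{ -1}(b)<v^{ -1}(a)$ if and only if $w^{ -1}(b)<w^{ -1}(b-1)<\cdots<w^{ -1}(a)$.
   Context: $J(w)=\{s_i: w^{ -1}(i+1)<w^{ -1}(i)\}$ is the left descent set of $w$, where $s_i=(i\ i+1)$. For a set $J$ of simple transpositions, $w_0(J)$ is the longest element of the subgroup of $S_n$ generated by $J$; explicitly, its one-line notation is an increasing sequence of consecutive decreasing runs $i+d,i+d-1,\dots,i$, one for each maximal block with $s_i,\dots,s_{i+d-1}\in J$ and $s_{i-1},s_{i+d}\notin J$. -}

module Defs where

open import Data.Nat using (ℕ; zero; suc; _+_; _∸_; _<?_)
open import Data.Bool using (Bool; true; false; if_then_else_)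
open import Data.Fin using (Fin; toℕ; fromℕ<)
open import Data.Fin.Permutation using (Permutation′; _⟨$⟩ˡ_; _∘ₚ_; transpose; id)
open import Data.List using (List; foldr; map) renaming (allFin to allFinL)
open import Data.Nat.Properties using (<-trans; n<1+n)
open import Relation.Nullary using (yes; no; does)

-- Conventions: permutations of {1,…,n} are elements of Permutation′ n acting on
-- Fin n, where the Fin element k stands for the number k+1.  The one-line
-- notation of w is  w ⟨$⟩ʳ_ , and w⁻¹ is  w ⟨$⟩ˡ_ .
-- A set J of simple transpositions is a Boolean predicate on ℕ:
-- J i ≡ true  means  s_i = (i i+1) ∈ J  (only 1 ≤ i ≤ n-1 is relevant).

-- The left descent set J(w) = { s_i : w⁻¹(i+1) < w⁻¹(i) }, for 1 ≤ i ≤ n-1.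
-- (1-indexed i, i+1 correspond to the Fin elements i-1, i.)
leftDescentSet : ∀ {n} → Permutation′ n → ℕ → Bool
leftDescentSet {n} w zero = false
leftDescentSet {n} w (suc i) with suc i <? n
... | no _ = false
... | yes p = does (toℕ (w ⟨$⟩ˡ fromℕ< p) <? toℕ (w ⟨$⟩ˡ fromℕ< {i} (<-trans (n<1+n i) p)))

-- Maximal block containing the (1-indexed) position p, for J ⊆ {s_1,…,s_{n-1}}:
-- blockLo p = least i ≤ p with s_i, …, s_{p-1} ∈ J,
-- blockHi p = greatest j ≥ p (j ≤ n) with s_p, …, s_{j-1} ∈ J.
blockLo : (ℕ → Bool) → ℕ → ℕ
blockLo J zero = zero
blockLo J (suc zero) = suc zero
blockLo J (suc (suc p)) = if J (suc p) then blockLo J (suc p) else suc (suc p)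

blockHiAux : (ℕ → Bool) → ℕ → ℕ → ℕ
blockHiAux J zero p = p
blockHiAux J (suc k) p = if J p then blockHiAux J k (suc p) else p

blockHi : ℕ → (ℕ → Bool) → ℕ → ℕ
blockHi n J p = blockHiAux J (n ∸ p) p

-- one-line value of w₀(J) at the 1-indexed position p: the block [lo,hi]
-- containing p is reversed, so p ↦ lo + hi − p.
w₀value : ℕ → (ℕ → Bool) → ℕ → ℕ
w₀value n J p = (blockLo J p + blockHi n J p) ∸ p

-- convert a number to Fin n, with a default when out of range (never used
-- for the values arising below)
toFinOr : ∀ {n} → Fin n → ℕ → Fin n
toFinOr {n} d k with k <? n
... | yes p = fromℕ< p
... | no _ = d

w₀image : ∀ {n} → (ℕ → Bool) → Fin n → Fin n
w₀image {n} J q = toFinOr q (w₀value n J (suc (toℕ q)) ∸ 1)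

-- w₀(J), the longest element of the parabolic subgroup generated by J, built
-- as the product of the (pairwise disjoint) transpositions (q, w₀image q)
-- with q < w₀image q; its one-line notation is the sequence of reversed
-- blocks described in the paper.
w₀ : ∀ {n} → (ℕ → Bool) → Permutation′ n
w₀ {n} J = foldr _∘ₚ_ id (map step (allFinL n))
  where
  step : Fin n → Permutation′ n
  step q = if does (toℕ q <? toℕ (w₀image J q)) then transpose q (w₀image J q) else id

-- v = w₀(J) reverses every maximal block [lo, hi] of J, p ↦ lo + hi − p, and
-- keeps the blocks in order. So for a < b, v⁻¹ = v swaps the order of a and b
-- exactly when a and b lie in one block, i.e. s_a, …, s_{b−1} ∈ J(w), which for
-- J = J(w) says w⁻¹(i+1) < w⁻¹(i) for a ≤ i < b. If some s_i with a ≤ i < b is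
-- missing, then v(a) ≤ hi(a) ≤ i < lo(b) ≤ v(b).
-- The product of the transpositions (q, f q), q < f q, defining w₀ acts as the
-- involution f : p ↦ lo + hi − p because a point y is moved only by the factor
-- indexed by the smaller of y and f y.

module Submission where

open import Defs

-- Opened locally so that Data.Nat's _<_ does not clash with Data.Fin's _<_ used
-- in the statement of proposition4p1.
module _ where
  open import Data.Bool using (Bool; true; false; if_then_else_) renaming (_≟_ to _≟ᵇ_)
  open import Data.Empty using (⊥-elim)
  open import Data.Fin using (Fin; zero; suc; toℕ; fromℕ<; _≟_)
  open import Data.Fin.Properties using (toℕ-injective; 0≢1+n; toℕ<n; toℕ-fromℕ<; fromℕ<-toℕ)
  open import Data.Fin.Permutation using (Permutation′; _⟨$⟩ˡ_; _∘ₚ_; transpose; id)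
  import Data.Fin.Permutation.Components as PC
  import Data.Fin.Properties as Fin
  open import Data.List using (List; []; _∷_; foldr; map; tabulate; allFin)
  open import Data.Nat using (ℕ; zero; suc; _≤_; _<_; _+_; _∸_; z≤n; s≤s; s≤s⁻¹; _≤′_; ≤′-reflexive; ≤′-step; _≤?_; _<?_)
  open import Data.Nat.Properties
    using (≤-refl; ≤-reflexive; ≤-trans; ≤-antisym; <-irrefl; <-asym; <-trans; ≤-<-trans; <-≤-trans;
           <⇒≤; <⇒≱; ≮⇒≥; ≰⇒>; n≤1+n; n<1+n; m≤n⇒m≤1+n; m<1+n⇒m<n∨m≡n; m≤n⇒m<n∨m≡n; ≤⇒≤′; ≤′⇒≤;
           m≤m+n; m≤n+m; +-suc; +-monoˡ-≤; +-∸-assoc; m+[n∸m]≡n; m∸[m∸n]≡n; ∸-monoʳ-<; suc-injective;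
           module ≤-Reasoning)
  open import Data.Product using (_×_; _,_; proj₁; proj₂)
  open import Data.Sum using (_⊎_; inj₁; inj₂)
  open import Function.Base using (_∘_; _$_)
  open import Function.Bundles using (_⇔_; mk⇔; module Equivalence)
  open import Function.Construct.Composition using (_⇔-∘_)
  open import Function.Definitions using (Injective)
  open import Relation.Binary.PropositionalEquality
  open import Relation.Nullary using (Dec; yes; no; does; ¬_)
  open import Relation.Nullary.Decidable using (dec-true; dec-false)

  transpose-matchˡ : ∀ {n} (i j : Fin n) → PC.transpose i j i ≡ j
  transpose-matchˡ i j with i ≟ i
  ... | yes _ = refl
  ... | no i≢i = ⊥-elim (i≢i refl)

  transpose-matchʳ : ∀ {n} (i j : Fin n) → j ≢ i → PC.transpose i j j ≡ i
  transpose-matchʳ i j j≢i with j ≟ i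
  ... | yes j≡i = ⊥-elim (j≢i j≡i)
  ... | no _ with j ≟ j
  ...   | yes _ = refl
  ...   | no j≢j = ⊥-elim (j≢j refl)

  transpose-fixes : ∀ {n} (i j k : Fin n) → k ≢ i → k ≢ j → PC.transpose i j k ≡ k
  transpose-fixes i j k k≢i k≢j with k ≟ i
  ... | yes k≡i = ⊥-elim (k≢i k≡i)
  ... | no _ with k ≟ j
  ...   | yes k≡j = ⊥-elim (k≢j k≡j)
  ...   | no _ = refl

  occurrences : ∀ {n} → Fin n → List (Fin n) → ℕ
  occurrences t [] = 0
  occurrences t (q ∷ qs) = if does (q ≟ t) then suc (occurrences t qs) else occurrences t qs

  occurrences-tabulate-∉ : ∀ {m n} (g : Fin m → Fin n) t → (∀ i → g i ≢ t) → occurrences t (tabulate g) ≡ 0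
  occurrences-tabulate-∉ {zero} g t t∉g = refl
  occurrences-tabulate-∉ {suc m} g t t∉g with g zero ≟ t
  ... | yes g0≡t = ⊥-elim (t∉g zero g0≡t)
  ... | no _ = occurrences-tabulate-∉ (g ∘ suc) t (λ i → t∉g (suc i))

  occurrences-tabulate-injective : ∀ {m n} (g : Fin m → Fin n) → Injective _≡_ _≡_ g →
                                   ∀ i → occurrences (g i) (tabulate g) ≡ 1
  occurrences-tabulate-injective {suc m} g g-inj i with g zero ≟ g i
  occurrences-tabulate-injective {suc m} g g-inj zero | yes _ =
    cong suc (occurrences-tabulate-∉ (g ∘ suc) (g zero) (λ i → 0≢1+n ∘ g-inj ∘ sym))
  occurrences-tabulate-injective {suc m} g g-inj (suc i) | yes e with () ← g-inj e
  occurrences-tabulate-injective {suc m} g g-inj zero | no g0≢g0 = ⊥-elim (g0≢g0 refl)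
  occurrences-tabulate-injective {suc m} g g-inj (suc i) | no _ =
    occurrences-tabulate-injective (g ∘ suc) (Fin.suc-injective ∘ g-inj) i

  module InvolutionProduct {n} (f : Fin n → Fin n) (f-involutive : ∀ x → f (f x) ≡ x) where

    swapStep : Fin n → Permutation′ n
    swapStep q = if does (toℕ q <? toℕ (f q)) then transpose q (f q) else id

    swapStep-active : ∀ {q} y → toℕ q < toℕ (f q) → swapStep q ⟨$⟩ˡ y ≡ PC.transpose (f q) q y
    swapStep-active {q} y q<fq =
      cong (λ b → (if b then transpose q (f q) else id) ⟨$⟩ˡ y) (dec-true (toℕ q <? toℕ (f q)) q<fq)

    swapStep-inactive : ∀ {q} y → ¬ toℕ q < toℕ (f q) → swapStep q ⟨$⟩ˡ y ≡ y
    swapStep-inactive {q} y q≮fq =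
      cong (λ b → (if b then transpose q (f q) else id) ⟨$⟩ˡ y) (dec-false (toℕ q <? toℕ (f q)) q≮fq)

    orbitMin : Fin n → Fin n
    orbitMin y with toℕ y ≤? toℕ (f y)
    ... | yes _ = y
    ... | no _ = f y

    orbitMin-cases : ∀ y → (orbitMin y ≡ y × toℕ y ≤ toℕ (f y)) ⊎ (orbitMin y ≡ f y × toℕ (f y) < toℕ y)
    orbitMin-cases y with toℕ y ≤? toℕ (f y)
    ... | yes y≤fy = inj₁ (refl , y≤fy)
    ... | no y≰fy = inj₂ (refl , ≰⇒> y≰fy)

    orbitMin-of-≤ : ∀ {y} → toℕ y ≤ toℕ (f y) → orbitMin y ≡ y
    orbitMin-of-≤ {y} y≤fy with orbitMin-cases y
    ... | inj₁ (e , _) = e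
    ... | inj₂ (_ , fy<y) = ⊥-elim (<⇒≱ fy<y y≤fy)

    orbitMin-≤ : ∀ y → toℕ (orbitMin y) ≤ toℕ (f (orbitMin y))
    orbitMin-≤ y with orbitMin-cases y
    ... | inj₁ (e , y≤fy) rewrite e = y≤fy
    ... | inj₂ (e , fy<y) rewrite e | f-involutive y = <⇒≤ fy<y

    orbitMin-∘f : ∀ y → orbitMin (f y) ≡ orbitMin y
    orbitMin-∘f y with orbitMin-cases (f y) | orbitMin-cases y
    ... | inj₁ (e , fy≤ffy) | inj₁ (e′ , y≤fy) =
      trans e (trans (toℕ-injective (≤-antisym fy≤y y≤fy)) (sym e′))
      where fy≤y = ≤-trans fy≤ffy (≤-reflexive (cong toℕ (f-involutive y)))
    ... | inj₁ (e , _) | inj₂ (e′ , _) = trans e (sym e′)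
    ... | inj₂ (e , ffy<fy) | _ =
      trans e (trans (f-involutive y) (sym (orbitMin-of-≤ (<⇒≤ y<fy))))
      where y<fy = ≤-<-trans (≤-reflexive (cong toℕ (sym (f-involutive y)))) ffy<fy

    orbitMin-orbit : ∀ y {q} → orbitMin y ≡ q → y ≡ q ⊎ y ≡ f q
    orbitMin-orbit y refl with orbitMin-cases y
    ... | inj₁ (e , _) = inj₁ (sym e)
    ... | inj₂ (e , _) = inj₂ (trans (sym (f-involutive y)) (cong f (sym e)))

    orbitMin-fixed : ∀ y {q} → orbitMin y ≡ q → ¬ toℕ q < toℕ (f q) → f q ≡ q
    orbitMin-fixed y e q≮fq =
      toℕ-injective (≤-antisym (≮⇒≥ q≮fq) (subst (λ x → toℕ x ≤ toℕ (f x)) e (orbitMin-≤ y)))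

    swapStep-moves : ∀ {y q} → orbitMin y ≡ q → swapStep q ⟨$⟩ˡ y ≡ f y
    swapStep-moves {y} {q} e with toℕ q <? toℕ (f q) | orbitMin-orbit y e
    ... | yes q<fq | inj₁ refl =
      trans (swapStep-active y q<fq) (transpose-matchʳ (f y) y (λ y≡fy → <-irrefl (cong toℕ y≡fy) q<fq))
    ... | yes q<fq | inj₂ refl =
      trans (swapStep-active (f q) q<fq) (trans (transpose-matchˡ (f q) q) (sym (f-involutive q)))
    ... | no q≮fq | inj₁ refl = trans (swapStep-inactive y q≮fq) (sym (orbitMin-fixed y e q≮fq))
    ... | no q≮fq | inj₂ refl =
      trans (swapStep-inactive (f q) q≮fq) (trans (orbitMin-fixed y e q≮fq) (sym (f-involutive q)))

    swapStep-fixes : ∀ {q} y → q ≢ orbitMin y → swapStep q ⟨$⟩ˡ y ≡ y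
    swapStep-fixes {q} y q≢min with toℕ q <? toℕ (f q)
    ... | no q≮fq = swapStep-inactive y q≮fq
    ... | yes q<fq = trans (swapStep-active y q<fq) (transpose-fixes (f q) q y y≢fq y≢q)
      where
      min-q : orbitMin q ≡ q
      min-q = orbitMin-of-≤ (<⇒≤ q<fq)
      y≢q : y ≢ q
      y≢q y≡q = q≢min (sym (trans (cong orbitMin y≡q) min-q))
      y≢fq : y ≢ f q
      y≢fq y≡fq = q≢min (sym (trans (cong orbitMin y≡fq) (trans (orbitMin-∘f q) min-q)))

    f^ : ℕ → Fin n → Fin n
    f^ zero y = y
    f^ (suc k) y = f (f^ k y)

    orbitMin-f^ : ∀ k y → orbitMin (f^ k y) ≡ orbitMin y
    orbitMin-f^ zero y = refl
    orbitMin-f^ (suc k) y = trans (orbitMin-∘f (f^ k y)) (orbitMin-f^ k y)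

    swapProduct : List (Fin n) → Permutation′ n
    swapProduct qs = foldr _∘ₚ_ id (map swapStep qs)

    swapProduct-inverse : ∀ qs y → swapProduct qs ⟨$⟩ˡ y ≡ f^ (occurrences (orbitMin y) qs) y
    swapProduct-inverse [] y = refl
    swapProduct-inverse (q ∷ qs) y with q ≟ orbitMin y
    ... | yes q≡min =
      trans (cong (swapStep q ⟨$⟩ˡ_) (swapProduct-inverse qs y))
            (swapStep-moves (trans (orbitMin-f^ k y) (sym q≡min)))
      where k = occurrences (orbitMin y) qs
    ... | no q≢min =
      trans (cong (swapStep q ⟨$⟩ˡ_) (swapProduct-inverse qs y))
            (swapStep-fixes (f^ k y) (λ q≡min′ → q≢min (trans q≡min′ (orbitMin-f^ k y))))
      where k = occurrences (orbitMin y) qs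

    swapProduct-allFin-inverse : ∀ y → swapProduct (allFin n) ⟨$⟩ˡ y ≡ f y
    swapProduct-allFin-inverse y = trans (swapProduct-inverse (allFin n) y) $
      cong (λ k → f^ k y) (occurrences-tabulate-injective (λ x → x) (λ e → e) (orbitMin y))

  -- s_p, …, s_{q−1} ∈ J: for p ≤ q, the positions p and q lie in one block of J.
  Linked : (ℕ → Bool) → ℕ → ℕ → Set
  Linked J p q = ∀ i → p ≤ i → i < q → J i ≡ true

  module _ {J : ℕ → Bool} where

    Linked-empty : ∀ {p q} → q ≤ p → Linked J p q
    Linked-empty q≤p i p≤i i<q = ⊥-elim (<⇒≱ (≤-<-trans p≤i i<q) q≤p)

    Linked-extendʳ : ∀ {p q} → Linked J p q → J q ≡ true → Linked J p (suc q)
    Linked-extendʳ linked Jq i p≤i i<1+q with m<1+n⇒m<n∨m≡n i<1+q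
    ... | inj₁ i<q = linked i p≤i i<q
    ... | inj₂ refl = Jq

    Linked-extendˡ : ∀ {p q} → J p ≡ true → Linked J (suc p) q → Linked J p q
    Linked-extendˡ Jp linked i p≤i i<q with m≤n⇒m<n∨m≡n p≤i
    ... | inj₁ p<i = linked i p<i i<q
    ... | inj₂ refl = Jp

    Linked-join : ∀ {p q r} → Linked J p q → Linked J q r → Linked J p r
    Linked-join {q = q} lpq lqr i p≤i i<r with i <? q
    ... | yes i<q = lpq i p≤i i<q
    ... | no i≮q = lqr i (≮⇒≥ i≮q) i<r

    Linked-restrictʳ : ∀ {p q r} → q ≤ r → Linked J p r → Linked J p q
    Linked-restrictʳ q≤r linked i p≤i i<q = linked i p≤i (<-≤-trans i<q q≤r)

    Linked-gapʳ : ∀ {p q i} → Linked J p q → J i ≢ true → p ≤ i → q ≤ i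
    Linked-gapʳ linked Ji≢true p≤i = ≮⇒≥ (λ i<q → Ji≢true (linked _ p≤i i<q))

    Linked-gapˡ : ∀ {p q i} → Linked J p q → J i ≢ true → i < q → i < p
    Linked-gapˡ linked Ji≢true i<q = ≰⇒> (λ p≤i → Ji≢true (linked _ p≤i i<q))

    blockLo-≤ : ∀ p → blockLo J p ≤ p
    blockLo-≤ zero = z≤n
    blockLo-≤ (suc zero) = ≤-refl
    blockLo-≤ (suc p@(suc _)) with J p | blockLo-≤ p
    ... | true | lo≤p = m≤n⇒m≤1+n lo≤p
    ... | false | _ = ≤-refl

    blockLo-positive : ∀ {p} → 1 ≤ p → 1 ≤ blockLo J p
    blockLo-positive {suc zero} _ = ≤-refl
    blockLo-positive {suc p@(suc _)} _ with J p | blockLo-positive {p} (s≤s z≤n)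
    ... | true | 1≤lo = 1≤lo
    ... | false | _ = s≤s z≤n

    blockLo-linked : ∀ p → Linked J (blockLo J p) p
    blockLo-linked zero = Linked-empty z≤n
    blockLo-linked (suc zero) = Linked-empty ≤-refl
    blockLo-linked (suc p@(suc _)) with J p in Jp | blockLo-linked p
    ... | true | linked = Linked-extendʳ linked Jp
    ... | false | _ = Linked-empty ≤-refl

    blockLo-step : ∀ {i} → 1 ≤ i → J i ≡ true → blockLo J (suc i) ≡ blockLo J i
    blockLo-step {suc i} _ Ji rewrite Ji = refl

    blockHiAux-≥ : ∀ k p → p ≤ blockHiAux J k p
    blockHiAux-≥ zero p = ≤-refl
    blockHiAux-≥ (suc k) p with J p
    ... | true = ≤-trans (n≤1+n p) (blockHiAux-≥ k (suc p))
    ... | false = ≤-refl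

    blockHiAux-≤ : ∀ k p → blockHiAux J k p ≤ p + k
    blockHiAux-≤ zero p = m≤m+n p 0
    blockHiAux-≤ (suc k) p with J p
    ... | true = subst (blockHiAux J k (suc p) ≤_) (sym (+-suc p k)) (blockHiAux-≤ k (suc p))
    ... | false = m≤m+n p (suc k)

    blockHiAux-linked : ∀ k p → Linked J p (blockHiAux J k p)
    blockHiAux-linked zero p = Linked-empty ≤-refl
    blockHiAux-linked (suc k) p with J p in Jp
    ... | true = Linked-extendˡ Jp (blockHiAux-linked k (suc p))
    ... | false = Linked-empty ≤-refl

    blockHi-≤ : ∀ {n p} → p ≤ n → blockHi n J p ≤ n
    blockHi-≤ {n} {p} p≤n = subst (blockHi n J p ≤_) (m+[n∸m]≡n p≤n) (blockHiAux-≤ (n ∸ p) p)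

    blockHi-step : ∀ {n i} → i < n → J i ≡ true → blockHi n J (suc i) ≡ blockHi n J i
    -- (1 + n) ∸ suc i reduces to n ∸ i, so +-∸-assoc exposes one unit of fuel.
    blockHi-step {n} {i} i<n Ji rewrite +-∸-assoc 1 i<n | Ji = refl

  module Blocks (n : ℕ) (J : ℕ → Bool) where

    lo hi g : ℕ → ℕ
    lo = blockLo J
    hi = blockHi n J
    g = w₀value n J

    blockHi-≥ : ∀ p → p ≤ hi p
    blockHi-≥ p = blockHiAux-≥ (n ∸ p) p

    blockHi-linked : ∀ p → Linked J p (hi p)
    blockHi-linked p = blockHiAux-linked (n ∸ p) p

    block-linked : ∀ p → Linked J (lo p) (hi p)
    block-linked p = Linked-join (blockLo-linked p) (blockHi-linked p)

    Linked⇒sameBlock : ∀ {p q} → 1 ≤ p → p ≤ q → q ≤ n → Linked J p q → lo q ≡ lo p × hi q ≡ hi p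
    Linked⇒sameBlock {p} 1≤p p≤q = go (≤⇒≤′ p≤q)
      where
      go : ∀ {q} → p ≤′ q → q ≤ n → Linked J p q → lo q ≡ lo p × hi q ≡ hi p
      go (≤′-reflexive refl) _ _ = refl , refl
      go {suc q} (≤′-step p≤′q) q<n linked =
        let p≤q = ≤′⇒≤ p≤′q
            Jq = linked q p≤q ≤-refl
            (lo-eq , hi-eq) = go p≤′q (<⇒≤ q<n) (Linked-restrictʳ (n≤1+n q) linked)
        in trans (blockLo-step (≤-trans 1≤p p≤q) Jq) lo-eq , trans (blockHi-step q<n Jq) hi-eq

    inBlock⇒sameBlock : ∀ {p q} → 1 ≤ p → p ≤ n → lo p ≤ q → q ≤ hi p → lo q ≡ lo p × hi q ≡ hi p
    inBlock⇒sameBlock {p} {q} 1≤p p≤n lo≤q q≤hi =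
      let (lo-q , hi-q) = fromLo lo≤q q≤hi
          (lo-p , hi-p) = fromLo (blockLo-≤ p) (blockHi-≥ p)
      in trans lo-q (sym lo-p) , trans hi-q (sym hi-p)
      where
      fromLo : ∀ {r} → lo p ≤ r → r ≤ hi p → lo r ≡ lo (lo p) × hi r ≡ hi (lo p)
      fromLo lo≤r r≤hi = Linked⇒sameBlock (blockLo-positive 1≤p) lo≤r (≤-trans r≤hi (blockHi-≤ p≤n))
                           (Linked-restrictʳ r≤hi (block-linked p))

    w₀value-≡ : ∀ p → g p ≡ lo p + (hi p ∸ p)
    w₀value-≡ p = +-∸-assoc (lo p) (blockHi-≥ p)

    w₀value-∈-block : ∀ p → lo p ≤ g p × g p ≤ hi p
    w₀value-∈-block p rewrite w₀value-≡ p =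
      m≤m+n (lo p) (hi p ∸ p) ,
      subst (lo p + (hi p ∸ p) ≤_) (m+[n∸m]≡n (blockHi-≥ p)) (+-monoˡ-≤ (hi p ∸ p) (blockLo-≤ p))

    w₀value-bounds : ∀ {p} → 1 ≤ p → p ≤ n → 1 ≤ g p × g p ≤ n
    w₀value-bounds {p} 1≤p p≤n =
      ≤-trans (blockLo-positive 1≤p) (proj₁ (w₀value-∈-block p)) ,
      ≤-trans (proj₂ (w₀value-∈-block p)) (blockHi-≤ p≤n)

    w₀value-involutive : ∀ {p} → 1 ≤ p → p ≤ n → g (g p) ≡ p
    w₀value-involutive {p} 1≤p p≤n =
      let (lo≤gp , gp≤hi) = w₀value-∈-block p
          (lo-eq , hi-eq) = inBlock⇒sameBlock 1≤p p≤n lo≤gp gp≤hi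
      in begin
        lo (g p) + hi (g p) ∸ g p ≡⟨ cong₂ (λ l h → l + h ∸ g p) lo-eq hi-eq ⟩
        lo p + hi p ∸ (lo p + hi p ∸ p) ≡⟨ m∸[m∸n]≡n (≤-trans (blockHi-≥ p) (m≤n+m (hi p) (lo p))) ⟩
        p ∎
      where open ≡-Reasoning

    w₀value-reversed⇔Linked : ∀ {p q} → 1 ≤ p → p < q → q ≤ n → g q < g p ⇔ Linked J p q
    w₀value-reversed⇔Linked {p} {q} 1≤p p<q q≤n = mk⇔ reversed⇒Linked Linked⇒reversed
      where
      reversed⇒Linked : g q < g p → Linked J p q
      reversed⇒Linked gq<gp i p≤i i<q with J i ≟ᵇ true
      ... | yes Ji = Ji
      ... | no Ji≢true = ⊥-elim (<-asym gq<gp gp<gq)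
        where
        gp<gq : g p < g q
        gp<gq = begin-strict
          g p  ≤⟨ proj₂ (w₀value-∈-block p) ⟩
          hi p ≤⟨ Linked-gapʳ (blockHi-linked p) Ji≢true p≤i ⟩
          i    <⟨ Linked-gapˡ (blockLo-linked q) Ji≢true i<q ⟩
          lo q ≤⟨ proj₁ (w₀value-∈-block q) ⟩
          g q  ∎
          where open ≤-Reasoning
      Linked⇒reversed : Linked J p q → g q < g p
      Linked⇒reversed linked =
        let (lo-eq , hi-eq) = Linked⇒sameBlock 1≤p (<⇒≤ p<q) q≤n linked
            q≤lo+hi = ≤-trans (blockHi-≥ q) (m≤n+m (hi q) (lo q))
        in subst₂ (λ l h → lo q + hi q ∸ q < l + h ∸ p) lo-eq hi-eq (∸-monoʳ-< p<q q≤lo+hi)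

  toFinOr-toℕ : ∀ {n} (d : Fin n) {k} → k < n → toℕ (toFinOr d k) ≡ k
  toFinOr-toℕ {n} d {k} k<n with k <? n
  ... | yes _ = toℕ-fromℕ< _
  ... | no k≮n = ⊥-elim (k≮n k<n)

  module LongestElement (n : ℕ) (J : ℕ → Bool) where
    open Blocks n J

    w₀image-toℕ : ∀ x → suc (toℕ (w₀image J x)) ≡ g (suc (toℕ x))
    w₀image-toℕ x = trans (cong suc (toFinOr-toℕ x (subst (_≤ n) (sym suc-pred) gx≤n))) suc-pred
      where
      gx = g (suc (toℕ x))
      bounds = w₀value-bounds (s≤s z≤n) (toℕ<n x)
      gx≤n = proj₂ bounds
      suc-pred : suc (gx ∸ 1) ≡ gx
      suc-pred = sym (+-∸-assoc 1 (proj₁ bounds))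

    w₀image-involutive : ∀ x → w₀image J (w₀image J x) ≡ x
    w₀image-involutive x = toℕ-injective $ suc-injective $ begin
      suc (toℕ (w₀image J (w₀image J x))) ≡⟨ w₀image-toℕ (w₀image J x) ⟩
      g (suc (toℕ (w₀image J x)))         ≡⟨ cong g (w₀image-toℕ x) ⟩
      g (g (suc (toℕ x)))                 ≡⟨ w₀value-involutive (s≤s z≤n) (toℕ<n x) ⟩
      suc (toℕ x)                         ∎
      where open ≡-Reasoning

    -- w₀ J is, by its definition, InvolutionProduct.swapProduct (w₀image J) _ (allFin n).
    w₀-inverse : ∀ x → w₀ J ⟨$⟩ˡ x ≡ w₀image J x
    w₀-inverse = InvolutionProduct.swapProduct-allFin-inverse (w₀image J) w₀image-involutive

    w₀-reversed⇔Linked : ∀ {a b : Fin n} → toℕ a < toℕ b →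
      toℕ (w₀ J ⟨$⟩ˡ b) < toℕ (w₀ J ⟨$⟩ˡ a) ⇔ Linked J (suc (toℕ a)) (suc (toℕ b))
    w₀-reversed⇔Linked {a} {b} a<b =
      w₀value-reversed⇔Linked (s≤s z≤n) (s≤s a<b) (toℕ<n b) ⇔-∘
      mk⇔ (λ lt → subst₂ _<_ (pos b) (pos a) (s≤s lt))
          (λ lt → s≤s⁻¹ (subst₂ _<_ (sym (pos b)) (sym (pos a)) lt))
      where
      pos : ∀ x → suc (toℕ (w₀ J ⟨$⟩ˡ x)) ≡ g (suc (toℕ x))
      pos x = trans (cong (λ y → suc (toℕ y)) (w₀-inverse x)) (w₀image-toℕ x)

  does≡true⇔ : ∀ {p} {P : Set p} (P? : Dec P) → does P? ≡ true ⇔ P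
  does≡true⇔ (yes p) = mk⇔ (λ _ → p) (λ _ → refl)
  does≡true⇔ (no ¬p) = mk⇔ (λ ()) (⊥-elim ∘ ¬p)

  leftDescentSet⇔descent : ∀ {n} (w : Permutation′ n) (j k : Fin n) → toℕ k ≡ suc (toℕ j) →
    leftDescentSet w (suc (toℕ j)) ≡ true ⇔ toℕ (w ⟨$⟩ˡ k) < toℕ (w ⟨$⟩ˡ j)
  leftDescentSet⇔descent {n} w j k k≡1+j with suc (toℕ j) <? n
  ... | no j+1≮n = ⊥-elim (j+1≮n (subst (_< n) k≡1+j (toℕ<n k)))
  ... | yes j+1<n
    rewrite fromℕ<-toℕ j (<-trans (n<1+n (toℕ j)) j+1<n)
          | toℕ-injective {i = fromℕ< j+1<n} {j = k} (trans (toℕ-fromℕ< j+1<n) (sym k≡1+j))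
    = does≡true⇔ (toℕ (w ⟨$⟩ˡ k) <? toℕ (w ⟨$⟩ˡ j))

  DescendingInverseRun : ∀ {n} → Permutation′ n → Fin n → Fin n → Set
  DescendingInverseRun {n} w a b = (j k : Fin n) → toℕ a ≤ toℕ j → toℕ k ≡ suc (toℕ j) → toℕ k ≤ toℕ b →
                                   toℕ (w ⟨$⟩ˡ k) < toℕ (w ⟨$⟩ˡ j)

  DescendingInverseRun⇔Linked : ∀ {n} (w : Permutation′ n) (a b : Fin n) →
    DescendingInverseRun w a b ⇔ Linked (leftDescentSet w) (suc (toℕ a)) (suc (toℕ b))
  DescendingInverseRun⇔Linked {n} w a b = mk⇔ run⇒Linked Linked⇒run
    where
    run⇒Linked : DescendingInverseRun w a b → Linked (leftDescentSet w) (suc (toℕ a)) (suc (toℕ b))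
    run⇒Linked run (suc i) (s≤s a≤i) (s≤s i<b) =
      subst (λ t → leftDescentSet w (suc t) ≡ true) (toℕ-fromℕ< i<n)
        (Equivalence.from (leftDescentSet⇔descent w j k k≡1+j) (run j k a≤j k≡1+j k≤b))
      where
      i<n = <-trans i<b (toℕ<n b)
      1+i<n = ≤-<-trans i<b (toℕ<n b)
      j k : Fin n
      j = fromℕ< i<n
      k = fromℕ< 1+i<n
      a≤j : toℕ a ≤ toℕ j
      a≤j = subst (toℕ a ≤_) (sym (toℕ-fromℕ< i<n)) a≤i
      k≡1+j : toℕ k ≡ suc (toℕ j)
      k≡1+j = trans (toℕ-fromℕ< 1+i<n) (cong suc (sym (toℕ-fromℕ< i<n)))
      k≤b : toℕ k ≤ toℕ b
      k≤b = subst (_≤ toℕ b) (sym (toℕ-fromℕ< 1+i<n)) i<b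
    Linked⇒run : Linked (leftDescentSet w) (suc (toℕ a)) (suc (toℕ b)) → DescendingInverseRun w a b
    Linked⇒run linked j k a≤j k≡1+j k≤b =
      Equivalence.to (leftDescentSet⇔descent w j k k≡1+j)
        (linked (suc (toℕ j)) (s≤s a≤j) (s≤s (subst (_≤ toℕ b) k≡1+j k≤b)))

open import Data.Nat using (ℕ; suc; _≤_)
open import Data.Fin using (Fin; toℕ; _<_)
open import Data.Fin.Permutation using (Permutation′; _⟨$⟩ˡ_)
open import Relation.Binary.PropositionalEquality using (_≡_)
open import Data.Product using (_×_; _,_)
open import Function.Bundles using (module Equivalence)
open import Function.Construct.Composition using (_⇔-∘_)
open import Function.Construct.Symmetry using (⇔-sym)

proposition4p1 : (n : ℕ) (w : Permutation′ n) (a b : Fin n) → a < b →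
    ((w₀ (leftDescentSet w) ⟨$⟩ˡ b) < (w₀ (leftDescentSet w) ⟨$⟩ˡ a)
      → ((j k : Fin n) → toℕ a ≤ toℕ j → toℕ k ≡ suc (toℕ j) → toℕ k ≤ toℕ b
          → (w ⟨$⟩ˡ k) < (w ⟨$⟩ˡ j)))
    × (((j k : Fin n) → toℕ a ≤ toℕ j → toℕ k ≡ suc (toℕ j) → toℕ k ≤ toℕ b
          → (w ⟨$⟩ˡ k) < (w ⟨$⟩ˡ j))
      → (w₀ (leftDescentSet w) ⟨$⟩ˡ b) < (w₀ (leftDescentSet w) ⟨$⟩ˡ a))
proposition4p1 n w a b a<b = to , from
  where
  open Equivalence
    (⇔-sym (DescendingInverseRun⇔Linked w a b) ⇔-∘ LongestElement.w₀-reversed⇔Linked n (leftDescentSet w) a<b)
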